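{- Let $n\ge 4$ be even and let $C_t$ be a $C$-wave configuration of $H_n$ of length $n$ with interrupter set $I$. Then in the $\frac12$-power index process on $H_n$, the configuration $C_{t+1}$ is a $D$-wave configuration of length $n$ with interrupter set \[I'=\{v_{i,1} : 1\le i\le n,\ \text{exactly one of } v_{i-1,2} \text{ and } v_{i+1,2} \text{ belongs to } I\},\] with column indices taken modulo $n$.
   Context: All graphs are finite and simple. A configuration of a graph $G$ is a map $C:V(G)\to\{C,D\}$; vertices with value $C$ are collaborators, those with value $D$ defectors. $N[v]$ is the closed neighbourhood of $v$, $N_C[v]$ is the set of collaborators in $N[v]$ and $N_D[v]$ the set of defectors in $N[v]$. For $w=\frac12$, the power of $v$ is: if $v$ is a collaborator, $p(v)=1/|N_C[v]|$ when $|N_C[v]|/|N[v]|>w$ and $0$ otherwise; if $v$ is a defector, $p(v)=1/|N_D[v]|$ when $|N_C[v]|/|N[v]|\le w$ and $0$ otherwise. The $w$-power index process produces $C_1,C_2,\dots$ from $C_0$: for $t\ge1$ each vertex $v$ simultaneously takes the strategy that, in $C_{t-1}$, is held by the vertex of $N[v]$ of greatest power (computed w.r.t. $C_{t-1}$); if the vertices of $N[v]$ of greatest power have differing strategies, $C_t(v)=C_{t-1}(v)$. The graph $H_n$: start from $C_n\square P_2$ with vertices $v_{i,j}$ ($1\le i\le n$, $j\in\{1,2\}$), where $v_{i,j}\sim v_{i\pm1,j}$ (indices mod $n$) and $v_{i,1}\sim v_{i,2}$; for each $v_{i,j}$ add a triangle on new vertices $x_{i,j},y_{i,j},z_{i,j}$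 and the edge $v_{i,j}z_{i,j}$. The configuration $W$ assigns $C$ to $v_{i,1},x_{i,1},y_{i,1},z_{i,1}$ and $D$ to $v_{i,2},x_{i,2},y_{i,2},z_{i,2}$ for all $i$. A wave configuration of length $n$ is obtained from $W$ by changing the strategy of the vertices in a set $I\subseteq\{v_{1,j},\dots,v_{n,j}\}$ for a single fixed $j$, such that $i_1\equiv i_2 \pmod 2$ whenever $v_{i_1,j},v_{i_2,j}\in I$; the elements of $I$ are its interrupters. It is a $C$-wave configuration if the interrupters are collaborators (i.e. $j=2$) and a $D$-wave configuration if the interrupters are defectors (i.e. $j=1$). -}

module Defs where

open import Data.Bool using (Bool; true; false; _∧_; _∨_; not; if_then_else_; _xor_)
open import Data.Nat using (ℕ; zero; suc; _+_; _*_; _<ᵇ_; _≤ᵇ_; _%_; _≤_; _<_; NonZero)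
open import Data.Nat.DivMod using (m%n<n)
open import Data.Fin using (Fin; toℕ; fromℕ<)
import Data.Fin as F
open import Data.Fin.Subset using (Subset; _∈_; inside; outside; Side)
open import Data.Vec using (lookup; tabulate)
open import Data.List using (List; []; _∷_; map; foldr; length; filterᵇ; allFin; cartesianProductWith)
open import Data.Product using (_×_; _,_)
open import Relation.Nullary.Decidable using (⌊_⌋)
open import Relation.Binary.PropositionalEquality using (_≡_)
open import Data.Integer using (+_)
open import Data.Rational using (ℚ; 0ℚ; _/_; _⊔_)
import Data.Rational.Properties as ℚP
open import Function using (_∘_)

-- Cyclic successor / predecessor on column indices (indices mod n).
-- Columns are Fin n = {0,…,n-1} (the paper's 1..n shifted by one).

cnext : ∀ {n} → Fin n → Fin n
cnext {suc m} i = fromℕ< (m%n<n (suc (toℕ i)) (suc m))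

cprev : ∀ {n} → Fin n → Fin n
cprev {suc m} i = fromℕ< (m%n<n (toℕ i + m) (suc m))

-- The graph H_n.
-- Rows: Fin 2, with 0 = the paper's j=1 and 1 = the paper's j=2.
-- A vertex is (i , j , k) where k says whether it is v_{i,j}, x_{i,j},
-- y_{i,j} or z_{i,j}.

data Kind : Set where
  vK xK yK zK : Kind

record Vtx (n : ℕ) : Set where
  constructor ⟨_,_,_⟩
  field
    col  : Fin n
    row  : Fin 2
    kind : Kind

open Vtx public

_==ᶠ_ : ∀ {m} → Fin m → Fin m → Bool
a ==ᶠ b = ⌊ a F.≟ b ⌋

_==ᵏ_ : Kind → Kind → Bool
vK ==ᵏ vK = true
xK ==ᵏ xK = true
yK ==ᵏ yK = true
zK ==ᵏ zK = true
_  ==ᵏ _  = false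

_==ᵛ_ : ∀ {n} → Vtx n → Vtx n → Bool
⟨ i , j , k ⟩ ==ᵛ ⟨ i' , j' , k' ⟩ = (i ==ᶠ i') ∧ (j ==ᶠ j') ∧ (k ==ᵏ k')

triangleKind : Kind → Bool
triangleKind vK = false
triangleKind _  = true

adj : ∀ {n} → Vtx n → Vtx n → Bool
adj ⟨ i , j , vK ⟩ ⟨ i' , j' , vK ⟩ =
  ((j ==ᶠ j') ∧ ((i' ==ᶠ cnext i) ∨ (i ==ᶠ cnext i')))
  ∨ ((i ==ᶠ i') ∧ not (j ==ᶠ j'))
adj ⟨ i , j , vK ⟩ ⟨ i' , j' , zK ⟩ = (i ==ᶠ i') ∧ (j ==ᶠ j')
adj ⟨ i , j , zK ⟩ ⟨ i' , j' , vK ⟩ = (i ==ᶠ i') ∧ (j ==ᶠ j')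
adj ⟨ i , j , k ⟩ ⟨ i' , j' , k' ⟩ =
  triangleKind k ∧ triangleKind k' ∧ not (k ==ᵏ k') ∧ (i ==ᶠ i') ∧ (j ==ᶠ j')

allKinds : List Kind
allKinds = vK ∷ xK ∷ yK ∷ zK ∷ []

vertices : ∀ n → List (Vtx n)
vertices n = cartesianProductWith (λ i → λ (jk : Fin 2 × Kind) → ⟨ i , Data.Product.proj₁ jk , Data.Product.proj₂ jk ⟩)
               (allFin n) (cartesianProductWith _,_ (allFin 2) allKinds)

N[_] : ∀ {n} → Vtx n → List (Vtx n)
N[_] {n} v = filterᵇ (λ w → (w ==ᵛ v) ∨ adj v w) (vertices n)

data Strategy : Set where
  C D : Strategy

isC : Strategy → Bool
isC C = true
isC D = false

isD : Strategy → Bool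
isD = not ∘ isC

Config : ℕ → Set
Config n = Vtx n → Strategy

nC nD nN : ∀ {n} → Config n → Vtx n → ℕ
nC cf v = length (filterᵇ (isC ∘ cf) N[ v ])
nD cf v = length (filterᵇ (isD ∘ cf) N[ v ])
nN cf v = length N[ v ]

-- 1/k as a rational (k = 0 never occurs where it is used, since v ∈ N[v])
recip : ℕ → ℚ
recip zero    = 0ℚ
recip (suc k) = + 1 / suc k

-- power for w = 1/2:  |N_C|/|N| > 1/2  ⇔  |N| < 2|N_C|
power : ∀ {n} → Config n → Vtx n → ℚ
power cf v with cf v
... | C = if nN cf v <ᵇ 2 * nC cf v then recip (nC cf v) else 0ℚ
... | D = if 2 * nC cf v ≤ᵇ nN cf v then recip (nD cf v) else 0ℚ

maxPower : ∀ {n} → Config n → Vtx n → ℚ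
maxPower cf v = foldr _⊔_ (power cf v) (map (power cf) N[ v ])

maximisers : ∀ {n} → Config n → Vtx n → List (Vtx n)
maximisers cf v = filterᵇ (λ w → ⌊ power cf w ℚP.≟ maxPower cf v ⌋) N[ v ]

allᵇ : ∀ {A : Set} → (A → Bool) → List A → Bool
allᵇ p = foldr (λ a b → p a ∧ b) true

step : ∀ {n} → Config n → Config n
step cf v =
  if allᵇ (isC ∘ cf) (maximisers cf v) then C
  else if allᵇ (isD ∘ cf) (maximisers cf v) then D
  else cf v

process : ∀ {n} → Config n → ℕ → Config n
process c0 zero    = c0
process c0 (suc t) = step (process c0 t)

W : ∀ {n} → Config n
W ⟨ _ , F.zero , _ ⟩ = C
W ⟨ _ , F.suc _ , _ ⟩ = D

flipS : Strategy → Strategy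
flipS C = D
flipS D = C

waveOf : ∀ {n} → Fin 2 → Subset n → Config n
waveOf j I ⟨ i , j' , vK ⟩ with lookup I i | j ==ᶠ j'
... | inside | true = flipS (W ⟨ i , j' , vK ⟩)
... | _      | _    = W ⟨ i , j' , vK ⟩
waveOf j I w = W w

SameParity : ∀ {n} → Subset n → Set
SameParity I = ∀ i₁ i₂ → i₁ ∈ I → i₂ ∈ I → toℕ i₁ % 2 ≡ toℕ i₂ % 2

IsWaveWith : ∀ {n} → Fin 2 → Subset n → Config n → Set
IsWaveWith j I cf = SameParity I × (∀ v → cf v ≡ waveOf j I v)

-- C-wave: interrupters in row 2 (collaborators); D-wave: row 1 (defectors)
IsCWaveWith IsDWaveWith : ∀ {n} → Subset n → Config n → Set
IsCWaveWith = IsWaveWith (F.suc F.zero)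
IsDWaveWith = IsWaveWith F.zero

inI : ∀ {n} → Subset n → Fin n → Bool
inI I i with lookup I i
... | inside  = true
... | outside = false

fromBool : Bool → Side
fromBool true  = inside
fromBool false = outside

nextInterrupters : ∀ {n} → Subset n → Subset n
nextInterrupters I = tabulate (λ i → fromBool (inI I (cprev i) xor inI I (cnext i)))

module Submission where

-- The update of a vertex only depends on the strategies and powers inside its closed neighbourhood,
-- and the power only on the strategies in the closed neighbourhood.  So the proof is local:
--  * the cycle arithmetic of cnext/cprev (inverse to each other, no short cycles for n ≥ 3, and
--    parity changing along the cycle when n is even);
--  * N[v] is a permutation of an explicit five- or four-element list closedNbhd v;
--  * the update rule is invariant under permuting N[v] and depends on the configuration pointwise,
--    so step can be evaluated on closedNbhd v;
--  * in a C-wave the power of every vertex is given by a small table in terms of whether the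
--    nearby columns are interrupters, and the new strategy of each kind of vertex follows by a
--    finite case analysis ("local rules"), using that equal parity forbids adjacent interrupters;
--  * the new interrupter set has equal parity again, since every new interrupter is adjacent to an
--    old one and adjacency changes parity.

open import Defs
open import Data.Bool using (Bool; true; false; if_then_else_; _∧_; _∨_; _xor_; T)
open import Data.Bool.Properties using (∧-assoc; ∧-comm)
open import Data.Nat using (ℕ; zero; suc; _+_; _*_; _≤_; _<_; _%_; _<ᵇ_; _≤ᵇ_; s≤s; z≤n; NonZero; >-nonZero)
open import Data.Nat.Properties using (+-comm; +-suc; +-cancelʳ-≡; <⇒≱; ≤-trans; n≤1+n)
open import Data.Nat.DivMod using (%-distribˡ-+; m%n%n≡m%n; [m+n]%n≡m%n; m<n⇒m%n≡m; m≡m%n+[m/n]*n; m∣n⇒o%n%m≡o%m; _/_)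
open import Data.Nat.Divisibility using (divides; ∣⇒≤; m%n≡0⇒n∣m)
open import Data.Fin using (Fin; toℕ)
open import Data.Fin.Subset using (Subset; Side; inside; outside; _∈_)
open import Data.Vec using (lookup)
open import Data.Vec.Properties using (lookup∘tabulate; []=⇒lookup; lookup⇒[]=)
import Data.Fin as F
import Data.Fin.Properties as FP
open import Data.List using (List; []; _∷_; _++_; map; filterᵇ; foldr; concat; tabulate; length; cartesianProductWith; allFin)
open import Data.List.Properties using (++-identityʳ; filter-++; filter-≐; tabulate-cong; map-∘; foldr-map; map-cong)
open import Data.List.Relation.Binary.Permutation.Propositional using (_↭_; ↭-refl; module PermutationReasoning)
import Data.List.Relation.Binary.Permutation.Propositional as Perm
open import Data.List.Relation.Binary.Permutation.Propositional.Properties using (++⁺ˡ; shifts; map⁺; filter-↭; ↭-length)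
open import Data.Product using (_×_; _,_; proj₁; proj₂; Σ-syntax)
open import Data.Empty using (⊥-elim)
open import Data.Rational using (ℚ; 0ℚ; _⊔_)
import Data.Rational.Properties as ℚP
open import Function using (_∘_)
open import Relation.Binary.PropositionalEquality
open import Relation.Nullary using (yes; no)
open import Relation.Nullary.Decidable using (⌊_⌋; T?; dec-true; dec-false; isYes≗does; ⌊⌋-map′)

==ᶠ-refl : ∀ {m} (i : Fin m) → (i ==ᶠ i) ≡ true
==ᶠ-refl i = trans (isYes≗does (i F.≟ i)) (dec-true (i F.≟ i) refl)

==ᶠ-false : ∀ {m} {a b : Fin m} → a ≢ b → (a ==ᶠ b) ≡ false
==ᶠ-false {a = a} {b} a≢b = trans (isYes≗does (a F.≟ b)) (dec-false (a F.≟ b) a≢b)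

==ᶠ-suc : ∀ {m} (a b : Fin m) → (F.suc a ==ᶠ F.suc b) ≡ (a ==ᶠ b)
==ᶠ-suc a b = ⌊⌋-map′ (cong F.suc) FP.suc-injective (a F.≟ b)

%-absorbˡ : ∀ a b n .{{_ : NonZero n}} → (a % n + b) % n ≡ (a + b) % n
%-absorbˡ a b n = begin
  (a % n + b) % n           ≡⟨ %-distribˡ-+ (a % n) b n ⟩
  (a % n % n + b % n) % n   ≡⟨ cong (λ x → (x + b % n) % n) (m%n%n≡m%n a n) ⟩
  (a % n + b % n) % n       ≡⟨ %-distribˡ-+ a b n ⟨
  (a + b) % n               ∎
  where open ≡-Reasoning

%-absorbʳ : ∀ a b n .{{_ : NonZero n}} → (a + b % n) % n ≡ (a + b) % n
%-absorbʳ a b n = begin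
  (a + b % n) % n  ≡⟨ cong (_% n) (+-comm a (b % n)) ⟩
  (b % n + a) % n  ≡⟨ %-absorbˡ b a n ⟩
  (b + a) % n      ≡⟨ cong (_% n) (+-comm b a) ⟩
  (a + b) % n      ∎
  where open ≡-Reasoning

toℕ-cnext : ∀ {m} (i : Fin (suc m)) → toℕ (cnext i) ≡ suc (toℕ i) % suc m
toℕ-cnext i = FP.toℕ-fromℕ< _

toℕ-cprev : ∀ {m} (i : Fin (suc m)) → toℕ (cprev i) ≡ (toℕ i + m) % suc m
toℕ-cprev i = FP.toℕ-fromℕ< _

toℕ-mod : ∀ {m} (i : Fin (suc m)) → toℕ i % suc m ≡ toℕ i
toℕ-mod i = m<n⇒m%n≡m (FP.toℕ<n i)

cprev-cnext : ∀ {n} (i : Fin n) → cprev (cnext i) ≡ i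
cprev-cnext {suc m} i = FP.toℕ-injective (begin
  toℕ (cprev (cnext i))             ≡⟨ toℕ-cprev (cnext i) ⟩
  (toℕ (cnext i) + m) % suc m       ≡⟨ cong (λ x → (x + m) % suc m) (toℕ-cnext i) ⟩
  (suc (toℕ i) % suc m + m) % suc m ≡⟨ %-absorbˡ (suc (toℕ i)) m (suc m) ⟩
  (suc (toℕ i) + m) % suc m         ≡⟨ cong (_% suc m) (+-suc (toℕ i) m) ⟨
  (toℕ i + suc m) % suc m           ≡⟨ [m+n]%n≡m%n (toℕ i) (suc m) ⟩
  toℕ i % suc m                     ≡⟨ toℕ-mod i ⟩
  toℕ i                             ∎)
  where open ≡-Reasoning

cnext-cprev : ∀ {n} (i : Fin n) → cnext (cprev i) ≡ i
cnext-cprev {suc m} i = FP.toℕ-injective (begin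
  toℕ (cnext (cprev i))                 ≡⟨ toℕ-cnext (cprev i) ⟩
  (1 + toℕ (cprev i)) % suc m           ≡⟨ cong (λ x → (1 + x) % suc m) (toℕ-cprev i) ⟩
  (1 + (toℕ i + m) % suc m) % suc m     ≡⟨ %-absorbʳ 1 (toℕ i + m) (suc m) ⟩
  (1 + (toℕ i + m)) % suc m             ≡⟨ cong (_% suc m) (+-suc (toℕ i) m) ⟨
  (toℕ i + suc m) % suc m               ≡⟨ [m+n]%n≡m%n (toℕ i) (suc m) ⟩
  toℕ i % suc m                         ≡⟨ toℕ-mod i ⟩
  toℕ i                                 ∎)
  where open ≡-Reasoning

shift≢ : ∀ {n} .{{_ : NonZero n}} k i → 0 < k → k < n → (k + i) % n ≢ i
shift≢ {n} k i 0<k k<n shift≡i = <⇒≱ k<n (∣⇒≤ {{>-nonZero 0<k}} (divides ((k + i) / n) k≡q*n))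
  where
  k≡q*n : k ≡ (k + i) / n * n
  k≡q*n = +-cancelʳ-≡ i k _ (begin
    k + i                          ≡⟨ m≡m%n+[m/n]*n (k + i) n ⟩
    (k + i) % n + (k + i) / n * n  ≡⟨ cong (_+ (k + i) / n * n) shift≡i ⟩
    i + (k + i) / n * n            ≡⟨ +-comm i _ ⟩
    (k + i) / n * n + i            ∎)
    where open ≡-Reasoning

cnext≢ : ∀ {n} → 2 ≤ n → (i : Fin n) → cnext i ≢ i
cnext≢ {suc m} (s≤s 1≤m) i e =
  shift≢ 1 (toℕ i) (s≤s z≤n) (s≤s 1≤m) (trans (sym (toℕ-cnext i)) (cong toℕ e))

cprev≢ : ∀ {n} → 2 ≤ n → (i : Fin n) → cprev i ≢ i
cprev≢ 2≤n i e = cnext≢ 2≤n i (trans (cong cnext (sym e)) (cnext-cprev i))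

cprev≢cnext : ∀ {n} → 3 ≤ n → (i : Fin n) → cprev i ≢ cnext i
cprev≢cnext {suc m} (s≤s 2≤m) i e = shift≢ 2 (toℕ i) (s≤s z≤n) (s≤s 2≤m) (begin
  (2 + toℕ i) % suc m                   ≡⟨ %-absorbʳ 1 (suc (toℕ i)) (suc m) ⟨
  (1 + suc (toℕ i) % suc m) % suc m     ≡⟨ cong (λ x → (1 + x) % suc m) (toℕ-cnext i) ⟨
  suc (toℕ (cnext i)) % suc m           ≡⟨ toℕ-cnext (cnext i) ⟨
  toℕ (cnext (cnext i))                 ≡⟨ cong (toℕ ∘ cnext) e ⟨
  toℕ (cnext (cprev i))                 ≡⟨ cong toℕ (cnext-cprev i) ⟩
  toℕ i                                 ∎)
  where open ≡-Reasoning

-- Parity.  Note that suc (suc a) % 2 and a % 2 are equal by computation, so parity-suc also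
-- cancels a common successor.

parity-suc≢ : ∀ a → a % 2 ≢ suc a % 2
parity-suc≢ zero ()
parity-suc≢ (suc zero) ()
parity-suc≢ (suc (suc a)) e = parity-suc≢ a e

parity-suc : ∀ {a b} → a % 2 ≡ b % 2 → suc a % 2 ≡ suc b % 2
parity-suc {a} {b} e = begin
  suc a % 2        ≡⟨ %-absorbʳ 1 a 2 ⟨
  (1 + a % 2) % 2  ≡⟨ cong (λ x → (1 + x) % 2) e ⟩
  (1 + b % 2) % 2  ≡⟨ %-absorbʳ 1 b 2 ⟩
  suc b % 2        ∎
  where open ≡-Reasoning

cnext-parity : ∀ {n} → n % 2 ≡ 0 → (i : Fin n) → toℕ (cnext i) % 2 ≡ suc (toℕ i) % 2
cnext-parity {suc m} even i =
  trans (cong (_% 2) (toℕ-cnext i)) (m∣n⇒o%n%m≡o%m 2 (suc m) (suc (toℕ i)) (m%n≡0⇒n∣m (suc m) 2 even))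

cprev-parity : ∀ {n} → n % 2 ≡ 0 → (i : Fin n) → toℕ (cprev i) % 2 ≡ suc (toℕ i) % 2
cprev-parity even i = sym (parity-suc {toℕ i} {suc (toℕ (cprev i))} (begin
  toℕ i % 2                    ≡⟨ cong (λ c → toℕ c % 2) (cnext-cprev i) ⟨
  toℕ (cnext (cprev i)) % 2    ≡⟨ cnext-parity even (cprev i) ⟩
  suc (toℕ (cprev i)) % 2      ∎))
  where open ≡-Reasoning

-- filterᵇ written with if_then_else_, so that it unfolds completely on a list of known shape.
filt : ∀ {A : Set} → (A → Bool) → List A → List A
filt p [] = []
filt p (x ∷ xs) = if p x then x ∷ filt p xs else filt p xs

filterᵇ≡filt : ∀ {A : Set} (p : A → Bool) xs → filterᵇ p xs ≡ filt p xs
filterᵇ≡filt p [] = refl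
filterᵇ≡filt p (x ∷ xs) with p x
... | true  = cong (x ∷_) (filterᵇ≡filt p xs)
... | false = filterᵇ≡filt p xs

inN : ∀ {n} → Vtx n → Vtx n → Bool
inN v w = (w ==ᵛ v) ∨ adj v w

column : ∀ {n} → Fin n → List (Vtx n)
column c = map (λ jk → ⟨ c , proj₁ jk , proj₂ jk ⟩) (cartesianProductWith _,_ (allFin 2) allKinds)

N-by-column : ∀ {n} (v : Vtx n) → N[ v ] ≡ concat (tabulate (λ c → filt (inN v) (column c)))
N-by-column {n} v = by-column n (λ c → c)
  where
  by-column : ∀ k (h : Fin k → Fin n) →
    filterᵇ (inN v) (cartesianProductWith (λ i (jk : Fin 2 × Kind) → ⟨ i , proj₁ jk , proj₂ jk ⟩) (tabulate h)
                       (cartesianProductWith _,_ (allFin 2) allKinds))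
      ≡ concat (tabulate (λ c → filt (inN v) (column (h c))))
  by-column zero h = refl
  by-column (suc k) h = trans (filter-++ (T? ∘ inN v) (column (h F.zero)) _)
                              (cong₂ _++_ (filterᵇ≡filt (inN v) (column (h F.zero))) (by-column k (h ∘ F.suc)))

module _ {A : Set} where

  erase : ∀ {n} → Fin n → (Fin n → List A) → Fin n → List A
  erase a g c = if c ==ᶠ a then [] else g c

  erase-other : ∀ {n} (g : Fin n → List A) {a c} → c ≢ a → erase a g c ≡ g c
  erase-other g c≢a rewrite ==ᶠ-false c≢a = refl

  erase-vanish : ∀ {n} (g : Fin n → List A) a c → (c ≢ a → g c ≡ []) → erase a g c ≡ []
  erase-vanish g a c vanish with c F.≟ a
  ... | yes _   = refl
  ... | no c≢a  = vanish c≢a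

  concat-extract : ∀ {n} (g : Fin n → List A) a →
    concat (tabulate g) ↭ g a ++ concat (tabulate (erase a g))
  concat-extract g F.zero    = ↭-refl
  concat-extract g (F.suc a) = begin
    g F.zero ++ concat (tabulate (g ∘ F.suc))
      ↭⟨ ++⁺ˡ (g F.zero) (concat-extract (g ∘ F.suc) a) ⟩
    g F.zero ++ g (F.suc a) ++ concat (tabulate (erase a (g ∘ F.suc)))
      ↭⟨ shifts (g F.zero) (g (F.suc a)) ⟩
    g (F.suc a) ++ g F.zero ++ concat (tabulate (erase a (g ∘ F.suc)))
      ≡⟨ cong (λ blocks → g (F.suc a) ++ g F.zero ++ concat blocks)
              (tabulate-cong (λ c → cong (λ b → if b then [] else g (F.suc c)) (==ᶠ-suc c a))) ⟨
    g (F.suc a) ++ concat (tabulate (erase (F.suc a) g)) ∎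
    where open PermutationReasoning

  concat-empty : ∀ {n} (g : Fin n → List A) → (∀ c → g c ≡ []) → concat (tabulate g) ≡ []
  concat-empty {zero}  g vanish = refl
  concat-empty {suc n} g vanish rewrite vanish F.zero = concat-empty (g ∘ F.suc) (vanish ∘ F.suc)

  concat-support₁ : ∀ {n} (g : Fin n → List A) a → (∀ c → c ≢ a → g c ≡ []) → concat (tabulate g) ↭ g a
  concat-support₁ g a vanish = begin
    concat (tabulate g)                       ↭⟨ concat-extract g a ⟩
    g a ++ concat (tabulate (erase a g))      ≡⟨ cong (g a ++_) (concat-empty _ (λ c → erase-vanish g a c (vanish c))) ⟩
    g a ++ []                                 ≡⟨ ++-identityʳ (g a) ⟩
    g a                                       ∎
    where open PermutationReasoning

  concat-support₃ : ∀ {n} (g : Fin n → List A) {a b d} → b ≢ a → d ≢ a → d ≢ b →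
    (∀ c → c ≢ a → c ≢ b → c ≢ d → g c ≡ []) → concat (tabulate g) ↭ g a ++ g b ++ g d
  concat-support₃ {n} g {a} {b} {d} b≢a d≢a d≢b vanish = begin
    concat (tabulate g)                                ↭⟨ concat-extract g a ⟩
    g a ++ concat (tabulate g₁)                        ↭⟨ ++⁺ˡ (g a) (concat-extract g₁ b) ⟩
    g a ++ g₁ b ++ concat (tabulate g₂)                ↭⟨ ++⁺ˡ (g a) (++⁺ˡ (g₁ b) (concat-extract g₂ d)) ⟩
    g a ++ g₁ b ++ g₂ d ++ concat (tabulate g₃)        ≡⟨ cong (λ r → g a ++ g₁ b ++ g₂ d ++ r) (concat-empty g₃ g₃-vanish) ⟩
    g a ++ g₁ b ++ g₂ d ++ []                          ≡⟨ cong₂ (λ x y → g a ++ x ++ y) (erase-other g b≢a)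
                                                               (trans (++-identityʳ (g₂ d)) (trans (erase-other g₁ d≢b) (erase-other g d≢a))) ⟩
    g a ++ g b ++ g d                                  ∎
    where
    open PermutationReasoning
    g₁ g₂ g₃ : Fin n → List A
    g₁ = erase a g
    g₂ = erase b g₁
    g₃ = erase d g₂
    g₃-vanish : ∀ c → g₃ c ≡ []
    g₃-vanish c = erase-vanish g₂ d c λ c≢d → erase-vanish g₁ b c λ c≢b → erase-vanish g a c λ c≢a → vanish c c≢a c≢b c≢d

ownColumn : ∀ {n} → Vtx n → List (Vtx n)
ownColumn ⟨ i , F.zero , vK ⟩       = ⟨ i , F.zero , vK ⟩ ∷ ⟨ i , F.zero , zK ⟩ ∷ ⟨ i , F.suc F.zero , vK ⟩ ∷ []
ownColumn ⟨ i , F.suc F.zero , vK ⟩ = ⟨ i , F.zero , vK ⟩ ∷ ⟨ i , F.suc F.zero , vK ⟩ ∷ ⟨ i , F.suc F.zero , zK ⟩ ∷ []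
ownColumn ⟨ i , j , zK ⟩            = ⟨ i , j , vK ⟩ ∷ ⟨ i , j , xK ⟩ ∷ ⟨ i , j , yK ⟩ ∷ ⟨ i , j , zK ⟩ ∷ []
ownColumn ⟨ i , j , xK ⟩            = ⟨ i , j , xK ⟩ ∷ ⟨ i , j , yK ⟩ ∷ ⟨ i , j , zK ⟩ ∷ []
ownColumn ⟨ i , j , yK ⟩            = ⟨ i , j , xK ⟩ ∷ ⟨ i , j , yK ⟩ ∷ ⟨ i , j , zK ⟩ ∷ []

ringPart : ∀ {n} → Vtx n → Fin n → List (Vtx n)
ringPart ⟨ i , j , vK ⟩ c = if (c ==ᶠ cnext i) ∨ (i ==ᶠ cnext c) then ⟨ c , j , vK ⟩ ∷ [] else []
ringPart _              c = []

closedNbhd : ∀ {n} → Vtx n → List (Vtx n)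
closedNbhd v@(⟨ i , j , vK ⟩) = ownColumn v ++ ⟨ cnext i , j , vK ⟩ ∷ ⟨ cprev i , j , vK ⟩ ∷ []
closedNbhd v                  = ownColumn v

col-own : ∀ {n} (v : Vtx n) → filt (inN v) (column (col v)) ≡ ownColumn v
col-own ⟨ i , F.zero , vK ⟩       rewrite ==ᶠ-refl i = refl
col-own ⟨ i , F.suc F.zero , vK ⟩ rewrite ==ᶠ-refl i = refl
col-own ⟨ i , F.zero , xK ⟩       rewrite ==ᶠ-refl i = refl
col-own ⟨ i , F.suc F.zero , xK ⟩ rewrite ==ᶠ-refl i = refl
col-own ⟨ i , F.zero , yK ⟩       rewrite ==ᶠ-refl i = refl
col-own ⟨ i , F.suc F.zero , yK ⟩ rewrite ==ᶠ-refl i = refl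
col-own ⟨ i , F.zero , zK ⟩       rewrite ==ᶠ-refl i = refl
col-own ⟨ i , F.suc F.zero , zK ⟩ rewrite ==ᶠ-refl i = refl

col-other : ∀ {n} (v : Vtx n) c → c ≢ col v → filt (inN v) (column c) ≡ ringPart v c
col-other ⟨ i , F.zero , vK ⟩ c c≢i rewrite ==ᶠ-false c≢i | ==ᶠ-false (≢-sym c≢i)
  with (c ==ᶠ cnext i) ∨ (i ==ᶠ cnext c)
... | true  = refl
... | false = refl
col-other ⟨ i , F.suc F.zero , vK ⟩ c c≢i rewrite ==ᶠ-false c≢i | ==ᶠ-false (≢-sym c≢i)
  with (c ==ᶠ cnext i) ∨ (i ==ᶠ cnext c)
... | true  = refl
... | false = refl
col-other ⟨ i , j , xK ⟩ c c≢i rewrite ==ᶠ-false c≢i | ==ᶠ-false (≢-sym c≢i) = refl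
col-other ⟨ i , j , yK ⟩ c c≢i rewrite ==ᶠ-false c≢i | ==ᶠ-false (≢-sym c≢i) = refl
col-other ⟨ i , j , zK ⟩ c c≢i rewrite ==ᶠ-false c≢i | ==ᶠ-false (≢-sym c≢i) = refl

-- ringPart at the two cycle neighbours of i, and at all other columns (n ≥ 3 keeps them apart)
ringPart-next : ∀ {n} (i : Fin n) j → ringPart ⟨ i , j , vK ⟩ (cnext i) ≡ ⟨ cnext i , j , vK ⟩ ∷ []
ringPart-next i j rewrite ==ᶠ-refl (cnext i) = refl

ringPart-prev : ∀ {n} → 3 ≤ n → ∀ (i : Fin n) j → ringPart ⟨ i , j , vK ⟩ (cprev i) ≡ ⟨ cprev i , j , vK ⟩ ∷ []
ringPart-prev 3≤n i j rewrite ==ᶠ-false (cprev≢cnext 3≤n i) | cnext-cprev i | ==ᶠ-refl i = refl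

ringPart-far : ∀ {n} (i : Fin n) j {c} → c ≢ cnext i → c ≢ cprev i → ringPart ⟨ i , j , vK ⟩ c ≡ []
ringPart-far i j {c} c≢next c≢prev
  rewrite ==ᶠ-false c≢next | ==ᶠ-false (λ i≡next → c≢prev (trans (sym (cprev-cnext c)) (cong cprev (sym i≡next)))) = refl

ownColumn-↭ : ∀ {n} (v : Vtx n) → (∀ c → ringPart v c ≡ []) → N[ v ] ↭ ownColumn v
ownColumn-↭ v noRing = begin
  N[ v ]                                          ≡⟨ N-by-column v ⟩
  concat (tabulate (λ c → filt (inN v) (column c))) ↭⟨ concat-support₁ _ (col v) (λ c c≢i → trans (col-other v c c≢i) (noRing c)) ⟩
  filt (inN v) (column (col v))                   ≡⟨ col-own v ⟩
  ownColumn v                                     ∎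
  where open PermutationReasoning

closedNbhd-↭ : ∀ {n} → 3 ≤ n → (v : Vtx n) → N[ v ] ↭ closedNbhd v
closedNbhd-↭ {n} 3≤n v@(⟨ i , j , vK ⟩) = begin
  N[ v ]                                 ≡⟨ N-by-column v ⟩
  concat (tabulate part)                 ↭⟨ concat-support₃ part (cnext≢ 2≤n i) (cprev≢ 2≤n i) (cprev≢cnext 3≤n i) far ⟩
  part i ++ part (cnext i) ++ part (cprev i)
    ≡⟨ cong₂ _++_ (col-own v) (cong₂ _++_ (trans (col-other v (cnext i) (cnext≢ 2≤n i)) (ringPart-next i j))
                                                (trans (col-other v (cprev i) (cprev≢ 2≤n i)) (ringPart-prev 3≤n i j))) ⟩
  closedNbhd v                           ∎
  where
  open PermutationReasoning
  2≤n : 2 ≤ n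
  2≤n = ≤-trans (n≤1+n 2) 3≤n
  part : Fin n → List (Vtx n)
  part c = filt (inN v) (column c)
  far : ∀ c → c ≢ i → c ≢ cnext i → c ≢ cprev i → part c ≡ []
  far c c≢i c≢next c≢prev = trans (col-other v c c≢i) (ringPart-far i j c≢next c≢prev)
closedNbhd-↭ 3≤n v@(⟨ _ , _ , xK ⟩) = ownColumn-↭ v (λ _ → refl)
closedNbhd-↭ 3≤n v@(⟨ _ , _ , yK ⟩) = ownColumn-↭ v (λ _ → refl)
closedNbhd-↭ 3≤n v@(⟨ _ , _ , zK ⟩) = ownColumn-↭ v (λ _ → refl)

foldr-↭ : ∀ {A : Set} (_∙_ : A → A → A) →
  (∀ x y z → (x ∙ y) ∙ z ≡ x ∙ (y ∙ z)) → (∀ x y → x ∙ y ≡ y ∙ x) →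
  ∀ e {xs ys} → xs ↭ ys → foldr _∙_ e xs ≡ foldr _∙_ e ys
foldr-↭ _∙_ assoc comm e Perm.refl          = refl
foldr-↭ _∙_ assoc comm e (Perm.prep x p)    = cong (x ∙_) (foldr-↭ _∙_ assoc comm e p)
foldr-↭ {A} _∙_ assoc comm e (Perm.swap {xs} {ys} x y p) = begin
  x ∙ (y ∙ foldr _∙_ e xs)  ≡⟨ cong (λ r → x ∙ (y ∙ r)) (foldr-↭ _∙_ assoc comm e p) ⟩
  x ∙ (y ∙ r)               ≡⟨ assoc x y r ⟨
  (x ∙ y) ∙ r               ≡⟨ cong (_∙ r) (comm x y) ⟩
  (y ∙ x) ∙ r               ≡⟨ assoc y x r ⟩
  y ∙ (x ∙ r)               ∎
  where
  open ≡-Reasoning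
  r : A
  r = foldr _∙_ e ys
foldr-↭ _∙_ assoc comm e (Perm.trans p q)   = trans (foldr-↭ _∙_ assoc comm e p) (foldr-↭ _∙_ assoc comm e q)

allᵇ-↭ : ∀ {A : Set} (p : A → Bool) {xs ys} → xs ↭ ys → allᵇ p xs ≡ allᵇ p ys
allᵇ-↭ p {xs} {ys} xs↭ys = begin
  allᵇ p xs                  ≡⟨ foldr-map _∧_ p true xs ⟨
  foldr _∧_ true (map p xs)  ≡⟨ foldr-↭ _∧_ ∧-assoc ∧-comm true (map⁺ p xs↭ys) ⟩
  foldr _∧_ true (map p ys)  ≡⟨ foldr-map _∧_ p true ys ⟩
  allᵇ p ys                  ∎
  where open ≡-Reasoning

filterᵇ-cong : ∀ {A : Set} {p q : A → Bool} → (∀ x → p x ≡ q x) → ∀ xs → filterᵇ p xs ≡ filterᵇ q xs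
filterᵇ-cong {p = p} {q} p≗q = filter-≐ (T? ∘ p) (T? ∘ q) ((λ {x} → subst T (p≗q x)) , (λ {x} → subst T (sym (p≗q x))))

powerOf : Strategy → ℕ → ℕ → ℕ → ℚ
powerOf C size nc nd = if size <ᵇ 2 * nc then recip nc else 0ℚ
powerOf D size nc nd = if 2 * nc ≤ᵇ size then recip nd else 0ℚ

power-powerOf : ∀ {n} (cf : Config n) v → power cf v ≡ powerOf (cf v) (nN cf v) (nC cf v) (nD cf v)
power-powerOf cf v with cf v
... | C = refl
... | D = refl

power-local : ∀ {n} → 3 ≤ n → ∀ (cf : Config n) v →
  power cf v ≡ powerOf (cf v) (length (closedNbhd v)) (length (filt (isC ∘ cf) (closedNbhd v)))
                       (length (filt (isD ∘ cf) (closedNbhd v)))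
power-local 3≤n cf v = begin
  power cf v                                       ≡⟨ power-powerOf cf v ⟩
  powerOf (cf v) (nN cf v) (nC cf v) (nD cf v)     ≡⟨ cong₂ (λ size nc → powerOf (cf v) size nc (nD cf v))
                                                            (↭-length (closedNbhd-↭ 3≤n v)) (count isC) ⟩
  powerOf (cf v) _ _ (nD cf v)                     ≡⟨ cong (powerOf (cf v) _ _) (count isD) ⟩
  powerOf (cf v) _ _ _                             ∎
  where
  open ≡-Reasoning
  count : (g : Strategy → Bool) → length (filterᵇ (g ∘ cf) N[ v ]) ≡ length (filt (g ∘ cf) (closedNbhd v))
  count g = trans (↭-length (filter-↭ (T? ∘ g ∘ cf) (closedNbhd-↭ 3≤n v))) (cong length (filterᵇ≡filt (g ∘ cf) (closedNbhd v)))

power-cong : ∀ {n} {cf cf' : Config n} → (∀ w → cf w ≡ cf' w) → ∀ v → power cf v ≡ power cf' v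
power-cong {cf = cf} {cf'} cf≗cf' v = begin
  power cf v                                      ≡⟨ power-powerOf cf v ⟩
  powerOf (cf v) (nN cf v) (nC cf v) (nD cf v)    ≡⟨ cong₂ (λ s nc → powerOf s (nN cf v) nc (nD cf v)) (cf≗cf' v) (count isC) ⟩
  powerOf (cf' v) (nN cf v) (nC cf' v) (nD cf v)  ≡⟨ cong (powerOf (cf' v) (nN cf v) (nC cf' v)) (count isD) ⟩
  powerOf (cf' v) (nN cf v) (nC cf' v) (nD cf' v) ≡⟨ power-powerOf cf' v ⟨
  power cf' v                                     ∎
  where
  open ≡-Reasoning
  count : (g : Strategy → Bool) → length (filterᵇ (g ∘ cf) N[ v ]) ≡ length (filterᵇ (g ∘ cf') N[ v ])
  count g = cong length (filterᵇ-cong (λ w → cong g (cf≗cf' w)) N[ v ])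

Profile : Set
Profile = ℚ × Strategy

profile : ∀ {n} → Config n → Vtx n → Profile
profile cf w = power cf w , cf w

decide : Profile → List Profile → Strategy
decide (p , s) ps = if allᵇ (isC ∘ proj₂) top then C else if allᵇ (isD ∘ proj₂) top then D else s
  where
  top : List Profile
  top = filterᵇ (λ q → ⌊ proj₁ q ℚP.≟ foldr _⊔_ p (map proj₁ ps) ⌋) ps

allᵇ-top-map : ∀ {A : Set} (f : A → Profile) (g : Strategy → Bool) m xs →
  allᵇ (g ∘ proj₂) (filterᵇ (λ q → ⌊ proj₁ q ℚP.≟ m ⌋) (map f xs))
    ≡ allᵇ (g ∘ proj₂ ∘ f) (filterᵇ (λ w → ⌊ proj₁ (f w) ℚP.≟ m ⌋) xs)
allᵇ-top-map f g m [] = refl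
allᵇ-top-map f g m (x ∷ xs) with ⌊ proj₁ (f x) ℚP.≟ m ⌋
... | true  = cong (g (proj₂ (f x)) ∧_) (allᵇ-top-map f g m xs)
... | false = allᵇ-top-map f g m xs

step-decide : ∀ {n} (cf : Config n) v → step cf v ≡ decide (profile cf v) (map (profile cf) N[ v ])
step-decide cf v = cong₂ (λ allC allD → if allC then C else if allD then D else cf v) (top isC) (top isD)
  where
  max≡ : maxPower cf v ≡ foldr _⊔_ (power cf v) (map proj₁ (map (profile cf) N[ v ]))
  max≡ = cong (foldr _⊔_ (power cf v)) (map-∘ N[ v ])
  top : ∀ g → allᵇ (g ∘ cf) (maximisers cf v)
            ≡ allᵇ (g ∘ proj₂) (filterᵇ (λ q → ⌊ proj₁ q ℚP.≟ foldr _⊔_ (power cf v) (map proj₁ (map (profile cf) N[ v ])) ⌋)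
                                        (map (profile cf) N[ v ]))
  top g = trans (cong (λ m → allᵇ (g ∘ cf) (filterᵇ (λ w → ⌊ power cf w ℚP.≟ m ⌋) N[ v ])) max≡)
                (sym (allᵇ-top-map (profile cf) g _ N[ v ]))

decide-↭ : ∀ self {ps qs} → ps ↭ qs → decide self ps ≡ decide self qs
decide-↭ (p , s) {ps} {qs} ps↭qs = cong₂ (λ allC allD → if allC then C else if allD then D else s) (top isC) (top isD)
  where
  max≡ : foldr _⊔_ p (map proj₁ ps) ≡ foldr _⊔_ p (map proj₁ qs)
  max≡ = foldr-↭ _⊔_ ℚP.⊔-assoc ℚP.⊔-comm p (map⁺ proj₁ ps↭qs)
  top : ∀ g → allᵇ (g ∘ proj₂) (filterᵇ (λ q → ⌊ proj₁ q ℚP.≟ foldr _⊔_ p (map proj₁ ps) ⌋) ps)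
            ≡ allᵇ (g ∘ proj₂) (filterᵇ (λ q → ⌊ proj₁ q ℚP.≟ foldr _⊔_ p (map proj₁ qs) ⌋) qs)
  top g = trans (cong (λ m → allᵇ (g ∘ proj₂) (filterᵇ (λ q → ⌊ proj₁ q ℚP.≟ m ⌋) ps)) max≡)
                (allᵇ-↭ (g ∘ proj₂) (filter-↭ (λ q → T? ⌊ proj₁ q ℚP.≟ foldr _⊔_ p (map proj₁ qs) ⌋) ps↭qs))

step-local : ∀ {n} → 3 ≤ n → ∀ (cf : Config n) v → step cf v ≡ decide (profile cf v) (map (profile cf) (closedNbhd v))
step-local 3≤n cf v = trans (step-decide cf v) (decide-↭ (profile cf v) (map⁺ (profile cf) (closedNbhd-↭ 3≤n v)))

step-cong : ∀ {n} {cf cf' : Config n} → (∀ w → cf w ≡ cf' w) → ∀ v → step cf v ≡ step cf' v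
step-cong {cf = cf} {cf'} cf≗cf' v = begin
  step cf v                                            ≡⟨ step-decide cf v ⟩
  decide (profile cf v) (map (profile cf) N[ v ])      ≡⟨ cong₂ decide (same v) (map-cong same N[ v ]) ⟩
  decide (profile cf' v) (map (profile cf') N[ v ])    ≡⟨ step-decide cf' v ⟨
  step cf' v                                           ∎
  where
  open ≡-Reasoning
  same : ∀ w → profile cf w ≡ profile cf' w
  same w = cong₂ _,_ (power-cong cf≗cf' w) (cf≗cf' w)

collaboratesIf defectsIf : Side → Strategy
collaboratesIf inside  = C
collaboratesIf outside = D
defectsIf inside  = D
defectsIf outside = C

-- the C-wave and D-wave configurations, written so that only the affected vertices consult I
cWave dWave : ∀ {n} → Subset n → Config n
cWave I ⟨ c , F.zero , vK ⟩       = C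
cWave I ⟨ c , F.suc F.zero , vK ⟩ = collaboratesIf (lookup I c)
cWave I w                         = W w
dWave I ⟨ c , F.zero , vK ⟩       = defectsIf (lookup I c)
dWave I ⟨ c , F.suc F.zero , vK ⟩ = D
dWave I w                         = W w

cWave-spec : ∀ {n} (I : Subset n) v → waveOf (F.suc F.zero) I v ≡ cWave I v
cWave-spec I ⟨ c , F.zero , vK ⟩ with lookup I c
... | inside  = refl
... | outside = refl
cWave-spec I ⟨ c , F.suc F.zero , vK ⟩ with lookup I c
... | inside  = refl
... | outside = refl
cWave-spec I ⟨ c , F.zero , xK ⟩       = refl
cWave-spec I ⟨ c , F.zero , yK ⟩       = refl
cWave-spec I ⟨ c , F.zero , zK ⟩       = refl
cWave-spec I ⟨ c , F.suc F.zero , xK ⟩ = refl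
cWave-spec I ⟨ c , F.suc F.zero , yK ⟩ = refl
cWave-spec I ⟨ c , F.suc F.zero , zK ⟩ = refl

dWave-spec : ∀ {n} (I : Subset n) v → waveOf F.zero I v ≡ dWave I v
dWave-spec I ⟨ c , F.zero , vK ⟩ with lookup I c
... | inside  = refl
... | outside = refl
dWave-spec I ⟨ c , F.suc F.zero , vK ⟩ with lookup I c
... | inside  = refl
... | outside = refl
dWave-spec I ⟨ c , F.zero , xK ⟩       = refl
dWave-spec I ⟨ c , F.zero , yK ⟩       = refl
dWave-spec I ⟨ c , F.zero , zK ⟩       = refl
dWave-spec I ⟨ c , F.suc F.zero , xK ⟩ = refl
dWave-spec I ⟨ c , F.suc F.zero , yK ⟩ = refl
dWave-spec I ⟨ c , F.suc F.zero , zK ⟩ = refl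

pv₁ : Side → ℚ
pv₁ inside  = recip 5
pv₁ outside = recip 4

pz₂ : Side → ℚ
pz₂ inside  = recip 3
pz₂ outside = recip 4

-- the power of v_{c,2} given whether c, c+1 and c-1 are interrupters
pv₂ : Side → Side → Side → ℚ
pv₂ inside  outside outside = 0ℚ
pv₂ inside  inside  outside = recip 3
pv₂ inside  outside inside  = recip 3
pv₂ inside  inside  inside  = recip 4
pv₂ outside outside outside = recip 4
pv₂ outside inside  outside = recip 3
pv₂ outside outside inside  = recip 3
pv₂ outside inside  inside  = 0ℚ

wavePower : ∀ {n} → Subset n → Vtx n → ℚ
wavePower I ⟨ c , F.zero , vK ⟩       = pv₁ (lookup I c)
wavePower I ⟨ c , F.suc F.zero , vK ⟩ = pv₂ (lookup I c) (lookup I (cnext c)) (lookup I (cprev c))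
wavePower I ⟨ c , F.zero , zK ⟩       = recip 4
wavePower I ⟨ c , F.suc F.zero , zK ⟩ = pz₂ (lookup I c)
wavePower I ⟨ c , _ , xK ⟩            = recip 3
wavePower I ⟨ c , _ , yK ⟩            = recip 3

wavePower-spec : ∀ {n} → 3 ≤ n → (I : Subset n) → ∀ v → power (cWave I) v ≡ wavePower I v
wavePower-spec 3≤n I v = trans (power-local 3≤n (cWave I) v) (table v)
  where
  table : ∀ v → powerOf (cWave I v) (length (closedNbhd v)) (length (filt (isC ∘ cWave I) (closedNbhd v)))
                        (length (filt (isD ∘ cWave I) (closedNbhd v))) ≡ wavePower I v
  table ⟨ c , F.zero , vK ⟩ with lookup I c
  ... | inside  = refl
  ... | outside = refl
  table ⟨ c , F.suc F.zero , vK ⟩ with lookup I c | lookup I (cnext c) | lookup I (cprev c)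
  ... | inside  | inside  | inside  = refl
  ... | inside  | inside  | outside = refl
  ... | inside  | outside | inside  = refl
  ... | inside  | outside | outside = refl
  ... | outside | inside  | inside  = refl
  ... | outside | inside  | outside = refl
  ... | outside | outside | inside  = refl
  ... | outside | outside | outside = refl
  table ⟨ c , F.zero , zK ⟩ = refl
  table ⟨ c , F.suc F.zero , zK ⟩ with lookup I c
  ... | inside  = refl
  ... | outside = refl
  table ⟨ c , F.zero , xK ⟩       = refl
  table ⟨ c , F.suc F.zero , xK ⟩ = refl
  table ⟨ c , F.zero , yK ⟩       = refl
  table ⟨ c , F.suc F.zero , yK ⟩ = refl

waveProfile : ∀ {n} → Subset n → Vtx n → Profile
waveProfile I w = wavePower I w , cWave I w

cWave-step-local : ∀ {n} → 3 ≤ n → (I : Subset n) → ∀ v →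
  step (cWave I) v ≡ decide (waveProfile I v) (map (waveProfile I) (closedNbhd v))
cWave-step-local 3≤n I v =
  trans (step-local 3≤n (cWave I) v) (cong₂ decide (same v) (map-cong same (closedNbhd v)))
  where
  same : ∀ w → profile (cWave I) w ≡ waveProfile I w
  same w = cong (_, cWave I w) (wavePower-spec 3≤n I w)

-- The local rules: the update of each kind of vertex of a C-wave, as a function of whether
-- the nearby columns are interrupters.  Adjacent columns are never both interrupters.

data Separated : Side → Side → Set where
  neither : Separated outside outside
  first   : Separated inside outside
  second  : Separated outside inside

exactlyOne : Side → Side → Side
exactlyOne inside  outside = inside
exactlyOne outside inside  = inside
exactlyOne _       _       = outside

-- v_{c,1} (neighbours v_{c,1}, z_{c,1}, v_{c,2}, v_{c+1,1}, v_{c-1,1})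
rule-v₁ : ∀ {l c r} → Separated l c → Separated c r →
  decide (pv₁ c , C) ((pv₁ c , C) ∷ (recip 4 , C) ∷ (pv₂ c r l , collaboratesIf c) ∷ (pv₁ r , C) ∷ (pv₁ l , C) ∷ [])
    ≡ defectsIf (exactlyOne l r)
rule-v₁ first   second  = refl
rule-v₁ first   neither = refl
rule-v₁ second  first   = refl
rule-v₁ neither second  = refl
rule-v₁ neither neither = refl

-- v_{c,2} (neighbours v_{c,1}, v_{c,2}, z_{c,2}, v_{c+1,2}, v_{c-1,2})
rule-v₂ : ∀ {ll l c r rr} → Separated ll l → Separated l c → Separated c r → Separated r rr →
  decide (pv₂ c r l , collaboratesIf c)
         ((pv₁ c , C) ∷ (pv₂ c r l , collaboratesIf c) ∷ (pz₂ c , D) ∷ (pv₂ r rr c , collaboratesIf r)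
                      ∷ (pv₂ l c ll , collaboratesIf l) ∷ [])
    ≡ D
rule-v₂ first   second  first   second  = refl
rule-v₂ first   second  first   neither = refl
rule-v₂ first   neither second  first   = refl
rule-v₂ first   neither neither second  = refl
rule-v₂ first   neither neither neither = refl
rule-v₂ second  first   second  first   = refl
rule-v₂ second  first   neither second  = refl
rule-v₂ second  first   neither neither = refl
rule-v₂ neither second  first   second  = refl
rule-v₂ neither second  first   neither = refl
rule-v₂ neither neither second  first   = refl
rule-v₂ neither neither neither second  = refl
rule-v₂ neither neither neither neither = refl

-- z_{c,1} (neighbours v_{c,1}, x_{c,1}, y_{c,1}, z_{c,1})
rule-z₁ : ∀ c → decide (recip 4 , C) ((pv₁ c , C) ∷ (recip 3 , C) ∷ (recip 3 , C) ∷ (recip 4 , C) ∷ []) ≡ C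
rule-z₁ inside  = refl
rule-z₁ outside = refl

-- z_{c,2} (neighbours v_{c,2}, x_{c,2}, y_{c,2}, z_{c,2})
rule-z₂ : ∀ {l c r} → Separated l c → Separated c r →
  decide (pz₂ c , D) ((pv₂ c r l , collaboratesIf c) ∷ (recip 3 , D) ∷ (recip 3 , D) ∷ (pz₂ c , D) ∷ []) ≡ D
rule-z₂ first   second  = refl
rule-z₂ first   neither = refl
rule-z₂ second  first   = refl
rule-z₂ neither second  = refl
rule-z₂ neither neither = refl

-- x_{c,2} and y_{c,2} (neighbours x_{c,2}, y_{c,2}, z_{c,2})
rule-xy₂ : ∀ c → decide (recip 3 , D) ((recip 3 , D) ∷ (recip 3 , D) ∷ (pz₂ c , D) ∷ []) ≡ D
rule-xy₂ inside  = refl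
rule-xy₂ outside = refl

nextInterrupters-lookup : ∀ {n} (I : Subset n) i →
  lookup (nextInterrupters I) i ≡ exactlyOne (lookup I (cprev i)) (lookup I (cnext i))
nextInterrupters-lookup I i rewrite lookup∘tabulate (λ j → fromBool (inI I (cprev j) xor inI I (cnext j))) i
  with lookup I (cprev i) | lookup I (cnext i)
... | inside  | inside  = refl
... | inside  | outside = refl
... | outside | inside  = refl
... | outside | outside = refl

-- the profiles around v_{i,2}, with the columns i±1±1 simplified to i
row₂-profiles : ∀ {n} (I : Subset n) i →
  let l = lookup I (cprev i) ; c = lookup I i ; r = lookup I (cnext i)
      ll = lookup I (cprev (cprev i)) ; rr = lookup I (cnext (cnext i)) in
  map (waveProfile I) (closedNbhd ⟨ i , F.suc F.zero , vK ⟩)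
    ≡ (pv₁ c , C) ∷ (pv₂ c r l , collaboratesIf c) ∷ (pz₂ c , D) ∷ (pv₂ r rr c , collaboratesIf r)
                  ∷ (pv₂ l c ll , collaboratesIf l) ∷ []
row₂-profiles I i =
  cong₂ (λ a b → (pv₁ c , C) ∷ (pv₂ c r l , collaboratesIf c) ∷ (pz₂ c , D) ∷ (pv₂ r rr (lookup I a) , collaboratesIf r)
                 ∷ (pv₂ l (lookup I b) ll , collaboratesIf l) ∷ [])
        (cprev-cnext i) (cnext-cprev i)
  where
  l c r ll rr : Side
  l = lookup I (cprev i)
  c = lookup I i
  r = lookup I (cnext i)
  ll = lookup I (cprev (cprev i))
  rr = lookup I (cnext (cnext i))

separated-prev : ∀ {n} (I : Subset n) → (∀ c → Separated (lookup I c) (lookup I (cnext c))) →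
  ∀ c → Separated (lookup I (cprev c)) (lookup I c)
separated-prev I sep c = subst (λ x → Separated (lookup I (cprev c)) (lookup I x)) (cnext-cprev c) (sep (cprev c))

cWave-step : ∀ {n} → 3 ≤ n → (I : Subset n) → (∀ c → Separated (lookup I c) (lookup I (cnext c))) →
  ∀ v → step (cWave I) v ≡ dWave (nextInterrupters I) v
cWave-step 3≤n I sep v@(⟨ i , F.zero , vK ⟩) = begin
  step (cWave I) v                                                   ≡⟨ cWave-step-local 3≤n I v ⟩
  decide (waveProfile I v) (map (waveProfile I) (closedNbhd v))      ≡⟨ rule-v₁ (separated-prev I sep i) (sep i) ⟩
  defectsIf (exactlyOne (lookup I (cprev i)) (lookup I (cnext i)))  ≡⟨ cong defectsIf (nextInterrupters-lookup I i) ⟨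
  dWave (nextInterrupters I) v                                       ∎
  where open ≡-Reasoning
cWave-step 3≤n I sep v@(⟨ i , F.suc F.zero , vK ⟩) =
  trans (cWave-step-local 3≤n I v)
        (trans (cong (decide (waveProfile I v)) (row₂-profiles I i))
               (rule-v₂ (separated-prev I sep (cprev i)) (separated-prev I sep i) (sep i) (sep (cnext i))))
cWave-step 3≤n I sep v@(⟨ i , F.zero , zK ⟩)       = trans (cWave-step-local 3≤n I v) (rule-z₁ (lookup I i))
cWave-step 3≤n I sep v@(⟨ i , F.suc F.zero , zK ⟩) = trans (cWave-step-local 3≤n I v) (rule-z₂ (separated-prev I sep i) (sep i))
cWave-step 3≤n I sep v@(⟨ i , F.zero , xK ⟩)       = cWave-step-local 3≤n I v
cWave-step 3≤n I sep v@(⟨ i , F.zero , yK ⟩)       = cWave-step-local 3≤n I v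
cWave-step 3≤n I sep v@(⟨ i , F.suc F.zero , xK ⟩) = trans (cWave-step-local 3≤n I v) (rule-xy₂ (lookup I i))
cWave-step 3≤n I sep v@(⟨ i , F.suc F.zero , yK ⟩) = trans (cWave-step-local 3≤n I v) (rule-xy₂ (lookup I i))

separated : ∀ {n} → n % 2 ≡ 0 → (I : Subset n) → SameParity I → ∀ c → Separated (lookup I c) (lookup I (cnext c))
separated even I same c with lookup I c in c∈I | lookup I (cnext c) in next∈I
... | outside | outside = neither
... | inside  | outside = first
... | outside | inside  = second
... | inside  | inside  = ⊥-elim (parity-suc≢ (toℕ c)
      (trans (same c (cnext c) (lookup⇒[]= c I c∈I) (lookup⇒[]= (cnext c) I next∈I)) (cnext-parity even c)))

interrupter-neighbour : ∀ {n} → n % 2 ≡ 0 → (I : Subset n) → ∀ i → i ∈ nextInterrupters I →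
  Σ[ x ∈ Fin n ] x ∈ I × toℕ x % 2 ≡ suc (toℕ i) % 2
interrupter-neighbour even I i i∈I' = neighbour (trans (sym (nextInterrupters-lookup I i)) ([]=⇒lookup i∈I'))
  where
  neighbour : exactlyOne (lookup I (cprev i)) (lookup I (cnext i)) ≡ inside → Σ[ x ∈ Fin _ ] x ∈ I × toℕ x % 2 ≡ suc (toℕ i) % 2
  neighbour with lookup I (cprev i) in prev∈I | lookup I (cnext i) in next∈I
  ... | inside  | _       = λ _ → cprev i , lookup⇒[]= (cprev i) I prev∈I , cprev-parity even i
  ... | outside | inside  = λ _ → cnext i , lookup⇒[]= (cnext i) I next∈I , cnext-parity even i
  ... | outside | outside = λ ()

nextInterrupters-sameParity : ∀ {n} → n % 2 ≡ 0 → (I : Subset n) → SameParity I → SameParity (nextInterrupters I)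
nextInterrupters-sameParity even I same i₁ i₂ i₁∈I' i₂∈I'
  with interrupter-neighbour even I i₁ i₁∈I' | interrupter-neighbour even I i₂ i₂∈I'
... | x₁ , x₁∈I , x₁-parity | x₂ , x₂∈I , x₂-parity =
  parity-suc {suc (toℕ i₁)} {suc (toℕ i₂)} (trans (sym x₁-parity) (trans (same x₁ x₂ x₁∈I x₂∈I) x₂-parity))

mainTheorem9 : (n : ℕ) → 4 ≤ n → n % 2 ≡ 0 →
    (C₀ : Config n) (t : ℕ) (I : Subset n) →
    IsCWaveWith I (process C₀ t) →
    IsDWaveWith (nextInterrupters I) (process C₀ (suc t))
mainTheorem9 n 4≤n even C₀ t I (same , isWave) = nextInterrupters-sameParity even I same , isNextWave
  where
  open ≡-Reasoning
  isNextWave : ∀ v → process C₀ (suc t) v ≡ waveOf F.zero (nextInterrupters I) v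
  isNextWave v = begin
    step (process C₀ t) v                  ≡⟨ step-cong (λ w → trans (isWave w) (cWave-spec I w)) v ⟩
    step (cWave I) v                       ≡⟨ cWave-step (≤-trans (n≤1+n 3) 4≤n) I (separated even I same) v ⟩
    dWave (nextInterrupters I) v           ≡⟨ dWave-spec (nextInterrupters I) v ⟨
    waveOf F.zero (nextInterrupters I) v   ∎
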